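{- Let $T$ be a finite sequence of nonempty binary codewords (a codeword $c$ of length $|c|$ is written $c[0]c[1]\cdots c[|c|-1]$). Define the levels of the wavelet matrix of $T$ as follows: $T_0=T$, and for $\ell\ge 0$, $T_{\ell+1}$ is obtained from $T_\ell$ by discarding the entries of length exactly $\ell$ (i.e., keeping those with $|c|\ge \ell+1$, in their order) and then stably partitioning the remaining entries by their bit $c[\ell]$: first all those with $c[\ell]=0$ in their order, then all those with $c[\ell]=1$ in their order. (The bitmap $B_\ell$ at level $\ell$ stores the bits $c[\ell]$ of the entries of $T_\ell$ of length greater than $\ell$, in order.) Let $c_1,c_2$ be two entries of $T$ (occurrences of codewords) that are both present in $T_\ell$ for some $\ell\ge 1$. If there is an $i$ with $0\le i<\ell$ such that $c_1[\ell-i..\ell-1]=c_2[\ell-i..\ell-1]$ and $c_1[\ell-i-1]=0\neq c_2[\ell-i-1]$, then $c_1$ appears before $c_2$ in $T_\ell$; and if there is such an $i$ with $c_1[\ell-i..\ell-1]=c_2[\ell-i..\ell-1]$ and $c_1[\ell-i-1]=1\neq c_2[\ell-i-1]$, then $c_1$ appears after $c_2$ in $T_\ell$.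
   Context: An entry with codeword of length $m$ is present in $T_\ell$ exactly for $0\le \ell\le m$. For $i=0$ the condition $c_1[\ell..\ell-1]=c_2[\ell..\ell-1]$ is the vacuous equality of empty strings. -}

module Defs where

open import Data.Nat using (ℕ; zero; suc; _<_; _≤_; _∸_; _≤?_; _<?_)
open import Data.Bool using (Bool; true; false; _≟_)
import Data.Fin
open import Data.Fin using (Fin)
open import Data.List using (List; []; _∷_; filter; _++_; length; lookup; tabulate)
open import Data.Maybe using (Maybe; just; nothing)
open import Data.Maybe.Properties using (≡-dec)
open import Data.Vec using (Vec)
import Data.Vec as Vec
open import Data.Product using (_×_; _,_; proj₂; ∃-syntax)
open import Relation.Binary.PropositionalEquality using (_≡_; _≢_)
open import Relation.Unary using (Pred)
open import Relation.Nullary using (Dec; yes; no)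
open import Level using (0ℓ)

Codeword : Set
Codeword = List Bool

bit : Codeword → ℕ → Maybe Bool
bit []      _       = nothing
bit (b ∷ c) zero    = just b
bit (b ∷ c) (suc j) = bit c j

-- An entry of T (an occurrence of a codeword): its position in T together with the codeword
Entry : ℕ → Set
Entry n = Fin n × Codeword

entry : ∀ {n} → Vec Codeword n → Fin n → Entry n
entry T p = p , Vec.lookup T p

longer? : ∀ {n} (ℓ : ℕ) (e : Entry n) → Dec (ℓ < length (proj₂ e))
longer? ℓ e = ℓ <? length (proj₂ e)

hasBit? : ∀ {n} (b : Bool) (ℓ : ℕ) (e : Entry n) → Dec (bit (proj₂ e) ℓ ≡ just b)
hasBit? b ℓ e = ≡-dec _≟_ (bit (proj₂ e) ℓ) (just b)

level : ∀ {n} → Vec Codeword n → ℕ → List (Entry n)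
level {n} T zero    = tabulate (entry T)
level {n} T (suc ℓ) =
  filter (hasBit? false ℓ) kept ++ filter (hasBit? true ℓ) kept
  where
  kept : List (Entry n)
  kept = filter (longer? ℓ) (level T ℓ)

_appearsBefore_within_ : ∀ {A : Set} → A → A → List A → Set
x appearsBefore y within xs = ∃[ a ] ∃[ b ] (Data.Fin.toℕ a < Data.Fin.toℕ b × lookup xs a ≡ x × lookup xs b ≡ y)

SplitAt : Codeword → Codeword → ℕ → Bool → Set
SplitAt c₁ c₂ ℓ b = ∃[ i ] (i < ℓ
  × (∀ j → ℓ ∸ i ≤ j → j < ℓ → bit c₁ j ≡ bit c₂ j)
  × bit c₁ (ℓ ∸ i ∸ 1) ≡ just b
  × bit c₂ (ℓ ∸ i ∸ 1) ≢ just b)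

module Submission where

-- Call two elements x, y "separated" in a list xs when
-- xs splits as us ++ vs with x ∉ vs and y ∉ us: every occurrence of x lies
-- before every occurrence of y.  Separation is the invariant that survives
-- the passage from one wavelet-matrix level to the next:
--   * filtering a separated list keeps it separated, so a stable partition
--     P-part ++ Q-part stays separated whenever x avoids the Q-part or y
--     avoids the P-part; in particular, if c_x[ℓ] = c_y[ℓ] then separation
--     in T_ℓ implies separation in T_{ℓ+1};
--   * if x avoids the 1-part and y avoids the 0-part, x and y are separated
--     in T_{ℓ+1} regardless of T_ℓ.
-- The split hypothesis at level ℓ+1 either splits the codewords at bit ℓ
-- (i = 0) or reduces to the split hypothesis at level ℓ with equal bits ℓ,
-- so induction on ℓ gives separation in T_ℓ; since both entries occur in
-- T_ℓ, separation yields the required order of their positions.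

open import Defs
open import Level using (0ℓ)
open import Data.Nat using (ℕ; zero; suc; _≤_; s≤s; z≤n)
open import Data.Nat.Properties using (m∸n≤m; n<1+n; m<n⇒m<1+n)
open import Data.Bool using (true; false)
open import Data.Maybe using (just)
open import Data.Fin using (Fin)
import Data.Fin as Fin
open import Data.List using (List; []; _∷_; _++_; filter)
open import Data.List.Properties using (filter-++; ++-assoc)
open import Data.List.Membership.Propositional using (_∈_; _∉_)
open import Data.List.Membership.Propositional.Properties
  using (∈-filter⁻; ∈-++⁻; ∈-++⁺ʳ)
open import Data.List.Relation.Unary.Any using (here; there; index)
open import Data.List.Relation.Unary.Any.Properties using (lookup-index)
open import Data.Vec using (Vec; lookup)
open import Data.Vec.Relation.Unary.All using (All)
open import Data.Product using (_×_; Σ-syntax; _,_; proj₁; proj₂)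
open import Data.Sum using (_⊎_; inj₁; inj₂; [_,_])
open import Data.Empty using (⊥-elim)
open import Relation.Nullary using (Dec; yes; no; ¬_)
open import Relation.Unary using (Pred)
open import Relation.Binary.PropositionalEquality using (_≡_; _≢_; refl; sym; trans)

Separated : {A : Set} → A → A → List A → Set
Separated x y xs = Σ[ us ∈ List _ ] Σ[ vs ∈ List _ ]
  (xs ≡ us ++ vs × x ∉ vs × y ∉ us)

∈-++-before : {A : Set} {x y : A} (us vs : List A) → x ∈ us → y ∈ vs →
  x appearsBefore y within (us ++ vs)
∈-++-before (u ∷ us) vs (here x≡u) y∈vs =
  Fin.zero , Fin.suc (index y∈us++vs) , s≤s z≤n , sym x≡u , sym (lookup-index y∈us++vs)
  where
  y∈us++vs = ∈-++⁺ʳ us y∈vs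
∈-++-before (u ∷ us) vs (there x∈us) y∈vs
  with a , b , a<b , at-a , at-b ← ∈-++-before us vs x∈us y∈vs =
  Fin.suc a , Fin.suc b , s≤s a<b , at-a , at-b

separated⇒before : {A : Set} {x y : A} {xs : List A} → Separated x y xs →
  x ∈ xs → y ∈ xs → x appearsBefore y within xs
separated⇒before (us , vs , refl , x∉vs , y∉us) x∈xs y∈xs
  with ∈-++⁻ us x∈xs | ∈-++⁻ us y∈xs
... | inj₂ x∈vs | _         = ⊥-elim (x∉vs x∈vs)
... | inj₁ _    | inj₁ y∈us = ⊥-elim (y∉us y∈us)
... | inj₁ x∈us | inj₂ y∈vs = ∈-++-before us vs x∈us y∈vs

module _ {A : Set} {x y : A} where

  separated-filter : {P : Pred A 0ℓ} (P? : ∀ a → Dec (P a)) (xs : List A) →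
    Separated x y xs → Separated x y (filter P? xs)
  separated-filter P? _ (us , vs , refl , x∉vs , y∉us) =
    filter P? us , filter P? vs , filter-++ P? us vs ,
    (λ x∈ → x∉vs (proj₁ (∈-filter⁻ P? {xs = vs} x∈))) ,
    (λ y∈ → y∉us (proj₁ (∈-filter⁻ P? {xs = us} y∈)))

  separated-++ʳ : (xs ys : List A) → Separated x y xs → x ∉ ys →
    Separated x y (xs ++ ys)
  separated-++ʳ _ ys (us , vs , refl , x∉vs , y∉us) x∉ys =
    us , vs ++ ys , ++-assoc us vs ys , (λ x∈ → [ x∉vs , x∉ys ] (∈-++⁻ vs x∈)) , y∉us

  separated-++ˡ : (xs ys : List A) → Separated x y ys → y ∉ xs →
    Separated x y (xs ++ ys)
  separated-++ˡ xs _ (us , vs , refl , x∉vs , y∉us) y∉xs =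
    xs ++ us , vs , sym (++-assoc xs us vs) , x∉vs , (λ y∈ → [ y∉xs , y∉us ] (∈-++⁻ xs y∈))

  module _ {P Q : Pred A 0ℓ} (P? : ∀ a → Dec (P a)) (Q? : ∀ a → Dec (Q a)) where

    partition : List A → List A
    partition xs = filter P? xs ++ filter Q? xs

    partition-separates : (xs : List A) → ¬ Q x → ¬ P y → Separated x y (partition xs)
    partition-separates xs ¬Qx ¬Py =
      filter P? xs , filter Q? xs , refl ,
      (λ x∈ → ¬Qx (proj₂ (∈-filter⁻ Q? {xs = xs} x∈))) ,
      (λ y∈ → ¬Py (proj₂ (∈-filter⁻ P? {xs = xs} y∈)))

    partition-preserves : (xs : List A) → ¬ Q x ⊎ ¬ P y →
      Separated x y xs → Separated x y (partition xs)
    partition-preserves xs (inj₁ ¬Qx) sep =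
      separated-++ʳ _ _ (separated-filter P? xs sep)
        (λ x∈ → ¬Qx (proj₂ (∈-filter⁻ Q? {xs = xs} x∈)))
    partition-preserves xs (inj₂ ¬Py) sep =
      separated-++ˡ _ _ (separated-filter Q? xs sep)
        (λ y∈ → ¬Py (proj₂ (∈-filter⁻ P? {xs = xs} y∈)))

0≢1 : just false ≢ just true
0≢1 ()

module _ {n : ℕ} (T : Vec Codeword n) {x y : Entry n} where

  level-separates : ∀ ℓ → bit (proj₂ x) ℓ ≢ just true → bit (proj₂ y) ℓ ≢ just false →
    Separated x y (level T (suc ℓ))
  level-separates ℓ =
    partition-separates (hasBit? false ℓ) (hasBit? true ℓ) (filter (longer? ℓ) (level T ℓ))

  -- Entries with equal bit ℓ keep their relative order from level ℓ to ℓ+1: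
  -- either x is not in the 1-part, or x and hence y are, so y is not in the
  -- 0-part.
  level-preserves : ∀ ℓ → bit (proj₂ x) ℓ ≡ bit (proj₂ y) ℓ →
    Separated x y (level T ℓ) → Separated x y (level T (suc ℓ))
  level-preserves ℓ same sep =
    partition-preserves (hasBit? false ℓ) (hasBit? true ℓ) (filter (longer? ℓ) (level T ℓ))
      x-or-y (separated-filter (longer? ℓ) (level T ℓ) sep)
    where
    x-or-y : bit (proj₂ x) ℓ ≢ just true ⊎ bit (proj₂ y) ℓ ≢ just false
    x-or-y with hasBit? true ℓ x
    ... | no  x≢1 = inj₁ x≢1
    ... | yes x≡1 = inj₂ λ y≡0 → 0≢1 (trans (sym y≡0) (trans (sym same) x≡1))

no-split-at-0 : ∀ {c₁ c₂ b} → ¬ SplitAt c₁ c₂ 0 b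
no-split-at-0 (_ , () , _)

split-cases : ∀ {c₁ c₂ ℓ b} → SplitAt c₁ c₂ (suc ℓ) b →
  (bit c₁ ℓ ≡ just b × bit c₂ ℓ ≢ just b) ⊎ (bit c₁ ℓ ≡ bit c₂ ℓ × SplitAt c₁ c₂ ℓ b)
split-cases (zero , _ , _ , c₁≡b , c₂≢b) = inj₁ (c₁≡b , c₂≢b)
split-cases {ℓ = ℓ} (suc i , s≤s i<ℓ , agree , c₁≡b , c₂≢b) =
  inj₂ (agree ℓ (m∸n≤m ℓ i) (n<1+n ℓ) ,
        i , i<ℓ , (λ j ℓ-i≤j j<ℓ → agree j ℓ-i≤j (m<n⇒m<1+n j<ℓ)) , c₁≡b , c₂≢b)

module _ {n : ℕ} (T : Vec Codeword n) (x y : Entry n) where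

  split-0-separates : ∀ ℓ → SplitAt (proj₂ x) (proj₂ y) ℓ false → Separated x y (level T ℓ)
  split-0-separates zero split = ⊥-elim (no-split-at-0 {proj₂ x} {proj₂ y} split)
  split-0-separates (suc ℓ) split with split-cases {proj₂ x} {proj₂ y} split
  ... | inj₁ (x≡0 , y≢0) = level-separates T ℓ (λ x≡1 → 0≢1 (trans (sym x≡0) x≡1)) y≢0
  ... | inj₂ (same , split′) = level-preserves T ℓ same (split-0-separates ℓ split′)

  split-1-separates : ∀ ℓ → SplitAt (proj₂ x) (proj₂ y) ℓ true → Separated y x (level T ℓ)
  split-1-separates zero split = ⊥-elim (no-split-at-0 {proj₂ x} {proj₂ y} split)
  split-1-separates (suc ℓ) split with split-cases {proj₂ x} {proj₂ y} split
  ... | inj₁ (x≡1 , y≢1) = level-separates T ℓ y≢1 (λ x≡0 → 0≢1 (trans (sym x≡0) x≡1))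
  ... | inj₂ (same , split′) = level-preserves T ℓ (sym same) (split-1-separates ℓ split′)

lemma2 : ∀ {n} (T : Vec Codeword n) → All (λ c → c ≢ []) T →
    (p q : Fin n) (ℓ : ℕ) → 1 ≤ ℓ →
    entry T p ∈ level T ℓ → entry T q ∈ level T ℓ →
    (SplitAt (lookup T p) (lookup T q) ℓ false →
        entry T p appearsBefore entry T q within level T ℓ)
    × (SplitAt (lookup T p) (lookup T q) ℓ true →
        entry T q appearsBefore entry T p within level T ℓ)
lemma2 T _ p q ℓ _ p∈Tℓ q∈Tℓ =
  (λ split → separated⇒before (split-0-separates T (entry T p) (entry T q) ℓ split) p∈Tℓ q∈Tℓ) ,
  (λ split → separated⇒before (split-1-separates T (entry T p) (entry T q) ℓ split) q∈Tℓ p∈Tℓ)
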